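{- Let $\mathbf{A}=(A_-,A_+,A)$ be a binary relation. Call a point $x$ deletable if either $x\in A_-$ and there is $z\in A_-$ with $N_{\mathbf{A}}(z)\subsetneq N_{\mathbf{A}}(x)$, or $x\in A_+$ and there is $z\in A_+$ with $N_{\mathbf{A}}(x)\subsetneq N_{\mathbf{A}}(z)$. Let $a$ be deletable in $\mathbf{A}$ and let $\mathbf{A}'$ be the induced subrelation obtained from $\mathbf{A}$ by deleting $a$. If $b\neq a$ is deletable in $\mathbf{A}$, then either $b$ is deletable in $\mathbf{A}'$, or $b$ has a twin in $\mathbf{A}'$, i.e. there is $c\neq b$ in the same set ($A_-$ or $A_+$) as $b$ with $N_{\mathbf{A}'}(c)=N_{\mathbf{A}'}(b)$.
   Context: A binary relation is a triple $\mathbf{A}=(A_-,A_+,A)$ where $A_-,A_+$ are sets and $A\subseteq A_-\times A_+$. Deleting $a\in A_-$ gives $(A_-\setminus\{a\},A_+,A\cap((A_-\setminus\{a\})\times A_+))$, and similarly for $a\in A_+$. For $x\in A_-\cup A_+$, the neighborhood $N_{\mathbf{A}}(x)$ is the set of $y\in A_-\cup A_+$ with $x\mathrel{A}y$ or $y\mathrel{A}x$; deletability in $\mathbf{A}'$ is defined in the same way using $N_{\mathbf{A}'}$. -}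

module Defs where

open import Data.Empty using (⊥)
open import Data.Product using (Σ; ∃; _×_; _,_)
open import Data.Sum using (_⊎_; inj₁; inj₂)
open import Relation.Nullary using (¬_)
open import Relation.Binary.PropositionalEquality using (_≡_; _≢_)

-- The sets A₋ and A₊ are given as
-- subsets (predicates) A₋ : M → Set and A₊ : P → Set of ambient types
-- M and P (so that deletion is simply shrinking a subset); the relation
-- A ⊆ A₋ × A₊ is the restriction of R : M → P → Set to A₋ × A₊.
record BinRel : Set₁ where
  field
    M  : Set
    P  : Set
    A₋ : M → Set
    A₊ : P → Set
    R  : M → P → Set
open BinRel public

-- Points of A₋ ∪ A₊ (A₋ and A₊ taken disjoint, as two sides).
Pt : BinRel → Set
Pt 𝐀 = M 𝐀 ⊎ P 𝐀

_∈ₚ_ : {𝐀 : BinRel} → Pt 𝐀 → BinRel → Set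
_∈ₚ_ {𝐀} (inj₁ m) _ = A₋ 𝐀 m
_∈ₚ_ {𝐀} (inj₂ p) _ = A₊ 𝐀 p

delete : (𝐀 : BinRel) → Pt 𝐀 → BinRel
delete 𝐀 a = record
  { M  = M 𝐀
  ; P  = P 𝐀
  ; A₋ = λ m → A₋ 𝐀 m × (inj₁ m ≢ a)
  ; A₊ = λ p → A₊ 𝐀 p × (inj₂ p ≢ a)
  ; R  = R 𝐀
  }

Rel : (𝐀 : BinRel) → M 𝐀 → P 𝐀 → Set
Rel 𝐀 m p = A₋ 𝐀 m × A₊ 𝐀 p × R 𝐀 m p

N : (𝐀 : BinRel) → Pt 𝐀 → Pt 𝐀 → Set
N 𝐀 (inj₁ x) (inj₁ y) = ⊥
N 𝐀 (inj₁ x) (inj₂ y) = Rel 𝐀 x y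
N 𝐀 (inj₂ x) (inj₁ y) = Rel 𝐀 y x
N 𝐀 (inj₂ x) (inj₂ y) = ⊥

_⊆_ : {X : Set} → (X → Set) → (X → Set) → Set
S ⊆ T = ∀ y → S y → T y

_⊂_ : {X : Set} → (X → Set) → (X → Set) → Set
S ⊂ T = (S ⊆ T) × (¬ (T ⊆ S))

_≐_ : {X : Set} → (X → Set) → (X → Set) → Set
S ≐ T = (S ⊆ T) × (T ⊆ S)

Deletable : (𝐀 : BinRel) → Pt 𝐀 → Set
Deletable 𝐀 (inj₁ x) =
  A₋ 𝐀 x × (∃ λ z → A₋ 𝐀 z × (N 𝐀 (inj₁ z) ⊂ N 𝐀 (inj₁ x)))
Deletable 𝐀 (inj₂ x) =
  A₊ 𝐀 x × (∃ λ z → A₊ 𝐀 z × (N 𝐀 (inj₂ x) ⊂ N 𝐀 (inj₂ z)))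

HasTwin : (𝐀 : BinRel) → Pt 𝐀 → Set
HasTwin 𝐀 (inj₁ b) =
  ∃ λ c → A₋ 𝐀 c × (c ≢ b) × (N 𝐀 (inj₁ c) ≐ N 𝐀 (inj₁ b))
HasTwin 𝐀 (inj₂ b) =
  ∃ λ c → A₊ 𝐀 c × (c ≢ b) × (N 𝐀 (inj₂ c) ≐ N 𝐀 (inj₂ b))

-- A strict inclusion N(z) ⊂ N(b) between neighbourhoods of surviving points
-- survives deleting a, except that it may collapse to an equality, in which
-- case z is a twin of b. The witness z itself may be a; then the witness w
-- of a's deletability works instead, by transitivity of ⊂, and w ≠ a since
-- its neighbourhood differs from that of a.
module Submission where

open import Axiom.ExcludedMiddle using (ExcludedMiddle)
open import Data.Empty using (⊥-elim)
open import Data.Product using (∃; _×_; _,_; proj₁; swap)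
open import Data.Sum using (_⊎_; inj₁; inj₂)
import Data.Sum as Sum
open import Function using (_∘_)
open import Level using (0ℓ)
open import Relation.Binary.PropositionalEquality using (_≡_; _≢_; refl)
open import Relation.Nullary using (¬_; yes; no)
open import Relation.Unary using (Pred; _∩_)

open import Defs

module _ {X : Set} where

  ⊆-trans : {S T U : Pred X 0ℓ} → S ⊆ T → T ⊆ U → S ⊆ U
  ⊆-trans S⊆T T⊆U y = T⊆U y ∘ S⊆T y

  ⊂-trans : {S T U : Pred X 0ℓ} → S ⊂ T → T ⊂ U → S ⊂ U
  ⊂-trans (S⊆T , T⊈S) (T⊆U , U⊈T) =
    ⊆-trans S⊆T T⊆U , λ U⊆S → T⊈S (⊆-trans T⊆U U⊆S)

  ⊂-irrefl : {S : Pred X 0ℓ} → ¬ (S ⊂ S)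
  ⊂-irrefl (S⊆S , S⊈S) = S⊈S S⊆S

  ⊂-resp-≐ : {S S′ T T′ : Pred X 0ℓ} → S ≐ S′ → T ≐ T′ → S ⊂ T → S′ ⊂ T′
  ⊂-resp-≐ (S⊆S′ , S′⊆S) (T⊆T′ , T′⊆T) (S⊆T , T⊈S) =
    ⊆-trans S′⊆S (⊆-trans S⊆T T⊆T′) ,
    λ T′⊆S′ → T⊈S (⊆-trans T⊆T′ (⊆-trans T′⊆S′ S′⊆S))

  ≐-resp-≐ : {S S′ T T′ : Pred X 0ℓ} → S ≐ S′ → T ≐ T′ → S ≐ T → S′ ≐ T′
  ≐-resp-≐ (S⊆S′ , S′⊆S) (T⊆T′ , T′⊆T) (S⊆T , T⊆S) =
    ⊆-trans S′⊆S (⊆-trans S⊆T T⊆T′) , ⊆-trans T′⊆T (⊆-trans T⊆S S⊆S′)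

  ∩-monoˡ-⊆ : {S T : Pred X 0ℓ} (Q : Pred X 0ℓ) → S ⊆ T → (S ∩ Q) ⊆ (T ∩ Q)
  ∩-monoˡ-⊆ Q S⊆T y (Sy , Qy) = S⊆T y Sy , Qy

  ∩-⊂-or-≐ : ExcludedMiddle 0ℓ → {S T : Pred X 0ℓ} (Q : Pred X 0ℓ) →
             S ⊂ T → (S ∩ Q) ⊂ (T ∩ Q) ⊎ (S ∩ Q) ≐ (T ∩ Q)
  ∩-⊂-or-≐ em {S} {T} Q (S⊆T , _) with em {∃ λ y → (T ∩ Q) y × ¬ S y}
  ... | yes (y , TQy , ¬Sy) =
    inj₁ (∩-monoˡ-⊆ Q S⊆T , λ TQ⊆SQ → ¬Sy (proj₁ (TQ⊆SQ y TQy)))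
  ... | no ∄y = inj₂ (∩-monoˡ-⊆ Q S⊆T , T∩Q⊆S∩Q)
    where
    T∩Q⊆S∩Q : (T ∩ Q) ⊆ (S ∩ Q)
    T∩Q⊆S∩Q y (Ty , Qy) with em {S y}
    ... | yes Sy = Sy , Qy
    ... | no ¬Sy = ⊥-elim (∄y (y , (Ty , Qy) , ¬Sy))

module Deletion (em : ExcludedMiddle 0ℓ) (𝐀 : BinRel) (a : Pt 𝐀) where

  N-delete : ∀ {u} → u ≢ a → N (delete 𝐀 a) u ≐ (N 𝐀 u ∩ (_≢ a))
  N-delete {inj₁ x} x≢a = to , from
    where
    to : N (delete 𝐀 a) (inj₁ x) ⊆ (N 𝐀 (inj₁ x) ∩ (_≢ a))
    to (inj₂ y) ((x∈ , _) , (y∈ , y≢a) , xRy) = (x∈ , y∈ , xRy) , y≢a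
    from : (N 𝐀 (inj₁ x) ∩ (_≢ a)) ⊆ N (delete 𝐀 a) (inj₁ x)
    from (inj₂ y) ((x∈ , y∈ , xRy) , y≢a) = (x∈ , x≢a) , (y∈ , y≢a) , xRy
  N-delete {inj₂ x} x≢a = to , from
    where
    to : N (delete 𝐀 a) (inj₂ x) ⊆ (N 𝐀 (inj₂ x) ∩ (_≢ a))
    to (inj₁ y) ((y∈ , y≢a) , (x∈ , _) , yRx) = (y∈ , x∈ , yRx) , y≢a
    from : (N 𝐀 (inj₂ x) ∩ (_≢ a)) ⊆ N (delete 𝐀 a) (inj₂ x)
    from (inj₁ y) ((y∈ , x∈ , yRx) , y≢a) = (y∈ , y≢a) , (x∈ , x≢a) , yRx

  delete-⊂-or-≐ : ∀ {u v} → u ≢ a → v ≢ a → N 𝐀 u ⊂ N 𝐀 v →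
    N (delete 𝐀 a) u ⊂ N (delete 𝐀 a) v ⊎ N (delete 𝐀 a) u ≐ N (delete 𝐀 a) v
  delete-⊂-or-≐ u≢a v≢a u⊂v =
    Sum.map (⊂-resp-≐ (swap (N-delete u≢a)) (swap (N-delete v≢a)))
            (≐-resp-≐ (swap (N-delete u≢a)) (swap (N-delete v≢a)))
            (∩-⊂-or-≐ em (_≢ a) u⊂v)

  surviving-witness₋ : ∀ {b z} → Deletable 𝐀 a → A₋ 𝐀 z →
    N 𝐀 (inj₁ z) ⊂ N 𝐀 (inj₁ b) →
    ∃ λ w → A₋ 𝐀 w × inj₁ w ≢ a × N 𝐀 (inj₁ w) ⊂ N 𝐀 (inj₁ b)
  surviving-witness₋ {z = z} _ z∈ z⊂b with em {inj₁ z ≡ a}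
  surviving-witness₋ (_ , w , w∈ , w⊂z) _ z⊂b | yes refl =
    w , w∈ , (λ { refl → ⊂-irrefl w⊂z }) , ⊂-trans w⊂z z⊂b
  ... | no z≢a = z , z∈ , z≢a , z⊂b

  surviving-witness₊ : ∀ {b z} → Deletable 𝐀 a → A₊ 𝐀 z →
    N 𝐀 (inj₂ b) ⊂ N 𝐀 (inj₂ z) →
    ∃ λ w → A₊ 𝐀 w × inj₂ w ≢ a × N 𝐀 (inj₂ b) ⊂ N 𝐀 (inj₂ w)
  surviving-witness₊ {z = z} _ z∈ b⊂z with em {inj₂ z ≡ a}
  surviving-witness₊ (_ , w , w∈ , z⊂w) _ b⊂z | yes refl =
    w , w∈ , (λ { refl → ⊂-irrefl z⊂w }) , ⊂-trans b⊂z z⊂w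
  ... | no z≢a = z , z∈ , z≢a , b⊂z

  deletable-or-twin : ∀ b → Deletable 𝐀 a → Deletable 𝐀 b → b ≢ a →
    Deletable (delete 𝐀 a) b ⊎ HasTwin (delete 𝐀 a) b
  deletable-or-twin (inj₁ b) da (b∈ , z , z∈ , z⊂b) b≢a
    with w , w∈ , w≢a , w⊂b ← surviving-witness₋ da z∈ z⊂b =
    Sum.map (λ w⊂′b → (b∈ , b≢a) , w , (w∈ , w≢a) , w⊂′b)
            (λ w≐′b → w , (w∈ , w≢a) , (λ { refl → ⊂-irrefl w⊂b }) , w≐′b)
            (delete-⊂-or-≐ w≢a b≢a w⊂b)
  deletable-or-twin (inj₂ b) da (b∈ , z , z∈ , b⊂z) b≢a
    with w , w∈ , w≢a , b⊂w ← surviving-witness₊ da z∈ b⊂z =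
    Sum.map (λ b⊂′w → (b∈ , b≢a) , w , (w∈ , w≢a) , b⊂′w)
            (λ b≐′w → w , (w∈ , w≢a) , (λ { refl → ⊂-irrefl b⊂w }) , swap b≐′w)
            (delete-⊂-or-≐ b≢a w≢a b⊂w)

lemma4p4 : ExcludedMiddle 0ℓ → (𝐀 : BinRel) (a b : Pt 𝐀) →
    Deletable 𝐀 a → Deletable 𝐀 b → b ≢ a →
    Deletable (delete 𝐀 a) b ⊎ HasTwin (delete 𝐀 a) b
lemma4p4 em 𝐀 a = Deletion.deletable-or-twin em 𝐀 a
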